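{- Let $A=(A_i)_{i\in\mathbb{Z}}$ be a closed axis-aligned $2n$-gon (with its $y$-parameters defined). Then for all $j\in\mathbb{Z}$, $$y_{2j}(A)=-\frac{s_{2j-1}s_{2j+1}}{s_{2j-3}s_{2j+3}}.$$
   Context: $A$ is a sequence of points of the affine plane $\mathbb{R}^2\subset\mathbb{RP}^2$ with $A_{i+2n}=A_i$ for all $i$ (closed), whose sides $A_iA_{i+1}$ are alternately parallel to the $x$-axis and the $y$-axis (axis-aligned). $s_{2j+1}$ denotes the signed length of the side joining $A_j$ and $A_{j+1}$, positive iff $A_{j+1}$ is to the right of or above $A_j$. $\overleftrightarrow{PQ}$ is the line through $P,Q$; the cross ratio of four concurrent lines is $\chi(a,b,c,d)=\frac{(a-b)(c-d)}{(a-c)(b-d)}$ (computable on slopes); $y_{2k}(A)=-\big(\chi(\overleftrightarrow{A_kA_{k-2}},\overleftrightarrow{A_kA_{k-1}},\overleftrightarrow{A_kA_{k+1}},\overleftrightarrow{A_kA_{k+2}})\big)^{ -1}$. -}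

module Defs where

open import Level using (Level; _⊔_) renaming (suc to lsuc)
open import Algebra.Bundles using (CommutativeRing)
open import Data.Bool using (Bool; true; false; not; if_then_else_)
open import Data.Nat using (ℕ)
open import Data.Integer using (ℤ; +_; -[1+_]) renaming (_+_ to _+ℤ_; _-_ to _-ℤ_)
open import Data.Product using (_×_; _,_; proj₁; proj₂)
open import Relation.Nullary using (¬_)

-- The value of 0⁻¹ is irrelevant (never used where
-- it matters, because every inverse below is guarded by a hypothesis).
record Field (c ℓ : Level) : Set (lsuc (c ⊔ ℓ)) where
  field
    commutativeRing : CommutativeRing c ℓ
  open CommutativeRing commutativeRing public
  infix 9 _⁻¹
  field
    _⁻¹       : Carrier → Carrier
    ⁻¹-cong   : ∀ {x y} → x ≈ y → x ⁻¹ ≈ y ⁻¹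
    ⁻¹-inverse : ∀ x → ¬ (x ≈ 0#) → x * x ⁻¹ ≈ 1#
    0≉1       : ¬ (0# ≈ 1#)

evenℕ : ℕ → Bool
evenℕ ℕ.zero    = true
evenℕ (ℕ.suc n) = not (evenℕ n)

evenℤ : ℤ → Bool
evenℤ (+ n)      = evenℕ n
evenℤ -[1+ n ]   = not (evenℕ n)

module Geometry {c ℓ : Level} (F : Field c ℓ) where
  open Field F

  Point : Set c
  Point = Carrier × Carrier

  xc yc : Point → Carrier
  xc = proj₁
  yc = proj₂

  _≈ₚ_ : Point → Point → Set ℓ
  P ≈ₚ Q = (xc P ≈ xc Q) × (yc P ≈ yc Q)

  PointSeq : Set c
  PointSeq = ℤ → Point

  Closed : ℕ → PointSeq → Set ℓ
  Closed n A = ∀ i → A (i +ℤ (+ (2 Data.Nat.* n))) ≈ₚ A i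

  -- The side A_j A_{j+1} is horizontal (parallel to the x-axis) iff
  -- horizontalSide h j = true; h says whether the side A_0 A_1 is horizontal.
  horizontalSide : Bool → ℤ → Bool
  horizontalSide h j = if evenℤ j then h else not h

  SideParallel : Bool → Point → Point → Set ℓ
  SideParallel true  P Q = yc P ≈ yc Q
  SideParallel false P Q = xc P ≈ xc Q

  AxisAligned : Bool → PointSeq → Set ℓ
  AxisAligned h A = ∀ j → SideParallel (horizontalSide h j) (A j) (A (j +ℤ + 1))

  -- signed length of the side A_j A_{j+1}, positive iff A_{j+1} is to the
  -- right of / above A_j.  In the paper's notation this is s_{2j+1}.
  sideLen : Bool → PointSeq → ℤ → Carrier
  sideLen h A j =
    if horizontalSide h j then xc (A (j +ℤ + 1)) - xc (A j)
                          else yc (A (j +ℤ + 1)) - yc (A j)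

  dir : Point → Point → Point
  dir P Q = (xc Q - xc P , yc Q - yc P)

  det : Point → Point → Carrier
  det u v = xc u * yc v - yc u * xc v

  -- On slopes m = v_y / v_x, (m_a - m_b)(m_c - m_d)/((m_a - m_c)(m_b - m_d))
  -- equals  det(a,b) det(c,d) / (det(a,c) det(b,d))  (the x-components
  -- cancel), which is the same formula extended to vertical lines (slope ∞).
  crossNum crossDen : Point → Point → Point → Point → Carrier
  crossNum a b c d = det a b * det c d
  crossDen a b c d = det a c * det b d

  χ : Point → Point → Point → Point → Carrier
  χ a b c d = crossNum a b c d * (crossDen a b c d) ⁻¹

  lineDirs : PointSeq → ℤ → Point × Point × Point × Point
  lineDirs A k = ( dir (A k) (A (k -ℤ + 2)) , dir (A k) (A (k -ℤ + 1))
                 , dir (A k) (A (k +ℤ + 1)) , dir (A k) (A (k +ℤ + 2)) )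

  χAt : PointSeq → ℤ → Carrier
  χAt A k with lineDirs A k
  ... | (a , b , c , d) = χ a b c d

  crossDenAt : PointSeq → ℤ → Carrier
  crossDenAt A k with lineDirs A k
  ... | (a , b , c , d) = crossDen a b c d

  y2 : PointSeq → ℤ → Carrier
  y2 A k = - ((χAt A k) ⁻¹)

  -- y_{2k}(A) is defined: the cross ratio is defined (nonzero denominator;
  -- this also forces the four lines to be defined, i.e. A_k ≠ A_{k±1}, A_{k±2})
  -- and nonzero (so that its inverse is defined).
  YDefined : PointSeq → ℤ → Set ℓ
  YDefined A k = ¬ (crossDenAt A k ≈ 0#) × ¬ (χAt A k ≈ 0#)

-- Put the origin at the vertex A_j and write s₀, s₁, s₂, s₃ for the paper's s_{2j-3},
-- s_{2j-1}, s_{2j+1}, s_{2j+3}.  Because the sides alternate between horizontal and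
-- vertical, the direction vectors from A_j to A_{j-2}, A_{j-1}, A_{j+1}, A_{j+2} are
-- (-s₀, -s₁), (0, -s₁), (s₂, 0), (s₂, s₃), up to exchanging the two coordinates.  The determinants in the cross ratio are then
-- monomials: χ = s₀s₁ · s₂s₃ / (s₁s₂)², so -χ⁻¹ = -s₁s₂ / (s₀s₃).
module Submission where

open import Defs
open import Level using (Level)
open import Data.Bool using (Bool; true; false; not; if_then_else_)
open import Data.Bool.Properties using (not-involutive)
open import Data.Nat using (ℕ; suc)
import Data.Nat.Properties as ℕ
open import Data.Integer using (ℤ; +_; -[1+_]) renaming (_+_ to _+ℤ_; _-_ to _-ℤ_)
open import Data.Integer.Tactic.RingSolver using (solve-∀)
open import Data.Product using (_×_; _,_; proj₁; proj₂; swap)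
open import Relation.Binary.PropositionalEquality as ≡ using (_≡_)

evenℤ-suc : ∀ i → evenℤ (i +ℤ + 1) ≡ not (evenℤ i)
evenℤ-suc (+ n) rewrite ℕ.+-comm n 1 = ≡.refl
evenℤ-suc -[1+ 0 ]     = ≡.refl
evenℤ-suc -[1+ suc n ] = ≡.sym (not-involutive _)

module _ {c ℓ : Level} (F : Field c ℓ) where
  open Field F
  open Geometry F
  open import Algebra.Properties.Ring ring
    using (-‿distribˡ-*; -‿involutive; -0#≈0#; ⁻¹-anti-homo‿-; x≈y⇒x∙y⁻¹≈ε)
  open import Algebra.Solver.CommutativeMonoid *-commutativeMonoid using (solve; _⊜_; _⊕_)
  open import Relation.Binary.Reasoning.Setoid setoid

  ⁻¹-unique : ∀ {x y} → x ≉ 0# → x * y ≈ 1# → x ⁻¹ ≈ y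
  ⁻¹-unique {x} {y} x≉0 xy≈1 = begin
    x ⁻¹             ≈⟨ *-identityʳ (x ⁻¹) ⟨
    x ⁻¹ * 1#        ≈⟨ *-congˡ xy≈1 ⟨
    x ⁻¹ * (x * y)   ≈⟨ *-assoc (x ⁻¹) x y ⟨
    x ⁻¹ * x * y     ≈⟨ *-congʳ (trans (*-comm (x ⁻¹) x) (⁻¹-inverse x x≉0)) ⟩
    1# * y           ≈⟨ *-identityˡ y ⟩
    y                ∎

  ⁻¹-ratio : ∀ {num den p q} → num ≈ p * q → den ≈ p * p →
             den ≉ 0# → num * den ⁻¹ ≉ 0# → (num * den ⁻¹) ⁻¹ ≈ p * q ⁻¹
  ⁻¹-ratio {num} {den} {p} {q} num≈pq den≈pp den≉0 ratio≉0 = ⁻¹-unique ratio≉0 (begin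
    num * den ⁻¹ * (p * q ⁻¹)              ≈⟨ *-congʳ (*-cong num≈pq (⁻¹-cong den≈pp)) ⟩
    p * q * (p * p) ⁻¹ * (p * q ⁻¹)        ≈⟨ regroup p q ((p * p) ⁻¹) (q ⁻¹) ⟩
    p * p * (p * p) ⁻¹ * (q * q ⁻¹)        ≈⟨ *-cong (⁻¹-inverse (p * p) pp≉0) (⁻¹-inverse q q≉0) ⟩
    1# * 1#                                ≈⟨ *-identityˡ 1# ⟩
    1#                                     ∎)
    where
    regroup : ∀ p q i j → p * q * i * (p * j) ≈ p * p * i * (q * j)
    regroup = solve 4 (λ p q i j → ((p ⊕ q) ⊕ i) ⊕ (p ⊕ j) ⊜ ((p ⊕ p) ⊕ i) ⊕ (q ⊕ j)) refl
    pp≉0 : p * p ≉ 0#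
    pp≉0 pp≈0 = den≉0 (trans den≈pp pp≈0)
    q≉0 : q ≉ 0#
    q≉0 q≈0 = ratio≉0 (begin
      num * den ⁻¹     ≈⟨ *-congʳ (trans num≈pq (*-congˡ q≈0)) ⟩
      p * 0# * den ⁻¹  ≈⟨ *-congʳ (zeroʳ p) ⟩
      0# * den ⁻¹      ≈⟨ zeroˡ (den ⁻¹) ⟩
      0#               ∎)

  x-y≈-[y-x] : ∀ x y → x - y ≈ - (y - x)
  x-y≈-[y-x] x y = sym (⁻¹-anti-homo‿- y x)

  -x*-y≈x*y : ∀ x y → - x * - y ≈ x * y
  -x*-y≈x*y x y = begin
    - x * - y        ≈⟨ -‿distribˡ-* x (- y) ⟨
    - (x * - y)      ≈⟨ -‿cong (trans (*-comm x (- y)) (sym (-‿distribˡ-* y x))) ⟩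
    - - (y * x)      ≈⟨ -‿involutive (y * x) ⟩
    y * x            ≈⟨ *-comm y x ⟩
    x * y            ∎

  -[-x*y]≈x*y : ∀ x y → - (- x * y) ≈ x * y
  -[-x*y]≈x*y x y = trans (-‿cong (sym (-‿distribˡ-* x y))) (-‿involutive (x * y))

  x-z≈x : ∀ {x z} → z ≈ 0# → x - z ≈ x
  x-z≈x {x} z≈0 = trans (+-congˡ (trans (-‿cong z≈0) -0#≈0#)) (+-identityʳ x)

  z-x≈-x : ∀ {x z} → z ≈ 0# → z - x ≈ - x
  z-x≈-x {x} z≈0 = trans (+-congʳ z≈0) (+-identityˡ (- x))

  det-verticalʳ : ∀ x y w → det (x , y) (0# , w) ≈ x * w
  det-verticalʳ x y w = x-z≈x (zeroʳ y)

  det-verticalˡ : ∀ y u w → det (0# , y) (u , w) ≈ - (y * u)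
  det-verticalˡ y u w = z-x≈-x (zeroˡ w)

  det-horizontalʳ : ∀ x y u → det (x , y) (u , 0#) ≈ - (y * u)
  det-horizontalʳ x y u = z-x≈-x (zeroʳ x)

  det-horizontalˡ : ∀ x u w → det (x , 0#) (u , w) ≈ x * w
  det-horizontalˡ x u w = x-z≈x (zeroˡ u)

  det-swap : ∀ u v → det (swap u) (swap v) ≈ - det u v
  det-swap (x , y) (u , w) = x-y≈-[y-x] (y * u) (x * w)

  det-cong : ∀ {u u′ v v′} → u ≈ₚ u′ → v ≈ₚ v′ → det u v ≈ det u′ v′
  det-cong (ux , uy) (vx , vy) = +-cong (*-cong ux vy) (-‿cong (*-cong uy vx))

  crossNum-cong : ∀ {a a′ b b′ c c′ d d′} → a ≈ₚ a′ → b ≈ₚ b′ → c ≈ₚ c′ → d ≈ₚ d′ →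
                  crossNum a b c d ≈ crossNum a′ b′ c′ d′
  crossNum-cong a b c d = *-cong (det-cong a b) (det-cong c d)

  crossDen-cong : ∀ {a a′ b b′ c c′ d d′} → a ≈ₚ a′ → b ≈ₚ b′ → c ≈ₚ c′ → d ≈ₚ d′ →
                  crossDen a b c d ≈ crossDen a′ b′ c′ d′
  crossDen-cong a b c d = *-cong (det-cong a c) (det-cong b d)

  crossNum-swap : ∀ a b c d → crossNum (swap a) (swap b) (swap c) (swap d) ≈ crossNum a b c d
  crossNum-swap a b c d = trans (*-cong (det-swap a b) (det-swap c d)) (-x*-y≈x*y _ _)

  crossDen-swap : ∀ a b c d → crossDen (swap a) (swap b) (swap c) (swap d) ≈ crossDen a b c d
  crossDen-swap a b c d = trans (*-cong (det-swap a c) (det-swap b d)) (-x*-y≈x*y _ _)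

  sideLength : Bool → Point → Point → Carrier
  sideLength b P Q = if b then xc Q - xc P else yc Q - yc P

  CornerCrossRatio : (P₀ P₁ P₂ P₃ P₄ : Point) (p q : Carrier) → Set ℓ
  CornerCrossRatio P₀ P₁ P₂ P₃ P₄ p q =
    crossNum (dir P₂ P₀) (dir P₂ P₁) (dir P₂ P₃) (dir P₂ P₄) ≈ p * q ×
    crossDen (dir P₂ P₀) (dir P₂ P₁) (dir P₂ P₃) (dir P₂ P₄) ≈ p * p

  cornerCrossRatio-swap : ∀ {P₀ P₁ P₂ P₃ P₄ p q} →
    CornerCrossRatio (swap P₀) (swap P₁) (swap P₂) (swap P₃) (swap P₄) p q →
    CornerCrossRatio P₀ P₁ P₂ P₃ P₄ p q
  cornerCrossRatio-swap {P₀} {P₁} {P₂} {P₃} {P₄} (num , den) =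
    trans (sym (crossNum-swap (dir P₂ P₀) (dir P₂ P₁) (dir P₂ P₃) (dir P₂ P₄))) num ,
    trans (sym (crossDen-swap (dir P₂ P₀) (dir P₂ P₁) (dir P₂ P₃) (dir P₂ P₄))) den

  cornerCrossRatio-horizontalStaircase : ∀ {P₀ P₁ P₂ P₃ P₄} →
    SideParallel true P₀ P₁ → SideParallel false P₁ P₂ →
    SideParallel true P₂ P₃ → SideParallel false P₃ P₄ →
    CornerCrossRatio P₀ P₁ P₂ P₃ P₄
      (sideLength false P₁ P₂ * sideLength true P₂ P₃)
      (sideLength true P₀ P₁ * sideLength false P₃ P₄)
  cornerCrossRatio-horizontalStaircase
    {x₀ , y₀} {x₁ , y₁} {x₂ , y₂} {x₃ , y₃} {x₄ , y₄} y₀≈y₁ x₁≈x₂ y₂≈y₃ x₃≈x₄ =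
    (begin
      crossNum _ _ _ _                                  ≈⟨ crossNum-cong a₀ a₁ a₃ a₄ ⟩
      det (- s₀ , - s₁) (0# , - s₁) * det (s₂ , 0#) (s₂ , s₃)
        ≈⟨ *-cong (det-verticalʳ (- s₀) (- s₁) (- s₁)) (det-horizontalˡ s₂ s₂ s₃) ⟩
      - s₀ * - s₁ * (s₂ * s₃)                           ≈⟨ *-congʳ (-x*-y≈x*y s₀ s₁) ⟩
      s₀ * s₁ * (s₂ * s₃)                               ≈⟨ regroup s₀ s₁ s₂ s₃ ⟩
      s₁ * s₂ * (s₀ * s₃)                               ∎) ,
    (begin
      crossDen _ _ _ _                                  ≈⟨ crossDen-cong a₀ a₁ a₃ a₄ ⟩
      det (- s₀ , - s₁) (s₂ , 0#) * det (0# , - s₁) (s₂ , s₃)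
        ≈⟨ *-cong (det-horizontalʳ (- s₀) (- s₁) s₂) (det-verticalˡ (- s₁) s₂ s₃) ⟩
      - (- s₁ * s₂) * - (- s₁ * s₂)                     ≈⟨ *-cong (-[-x*y]≈x*y s₁ s₂) (-[-x*y]≈x*y s₁ s₂) ⟩
      s₁ * s₂ * (s₁ * s₂)                               ∎)
    where
    s₀ s₁ s₂ s₃ : Carrier
    s₀ = x₁ - x₀
    s₁ = y₂ - y₁
    s₂ = x₃ - x₂
    s₃ = y₄ - y₃
    a₀ : (x₀ - x₂ , y₀ - y₂) ≈ₚ (- s₀ , - s₁)
    a₀ = trans (+-congˡ (-‿cong (sym x₁≈x₂))) (x-y≈-[y-x] x₀ x₁) ,
         trans (+-congʳ y₀≈y₁) (x-y≈-[y-x] y₁ y₂)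
    a₁ : (x₁ - x₂ , y₁ - y₂) ≈ₚ (0# , - s₁)
    a₁ = x≈y⇒x∙y⁻¹≈ε x₁≈x₂ , x-y≈-[y-x] y₁ y₂
    a₃ : (x₃ - x₂ , y₃ - y₂) ≈ₚ (s₂ , 0#)
    a₃ = refl , x≈y⇒x∙y⁻¹≈ε (sym y₂≈y₃)
    a₄ : (x₄ - x₂ , y₄ - y₂) ≈ₚ (s₂ , s₃)
    a₄ = +-congʳ (sym x₃≈x₄) , +-congˡ (-‿cong y₂≈y₃)
    regroup : ∀ a b c d → a * b * (c * d) ≈ b * c * (a * d)
    regroup = solve 4 (λ a b c d → (a ⊕ b) ⊕ (c ⊕ d) ⊜ (b ⊕ c) ⊕ (a ⊕ d)) refl

  -- Exchanging the coordinates turns a staircase starting with a vertical side into one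
  -- starting with a horizontal side.
  cornerCrossRatio-staircase : ∀ b₀ {b₁ b₂ b₃ P₀ P₁ P₂ P₃ P₄} →
    b₁ ≡ not b₀ → b₂ ≡ not b₁ → b₃ ≡ not b₂ →
    SideParallel b₀ P₀ P₁ → SideParallel b₁ P₁ P₂ →
    SideParallel b₂ P₂ P₃ → SideParallel b₃ P₃ P₄ →
    CornerCrossRatio P₀ P₁ P₂ P₃ P₄
      (sideLength b₁ P₁ P₂ * sideLength b₂ P₂ P₃)
      (sideLength b₀ P₀ P₁ * sideLength b₃ P₃ P₄)
  cornerCrossRatio-staircase true ≡.refl ≡.refl ≡.refl = cornerCrossRatio-horizontalStaircase
  cornerCrossRatio-staircase false {P₀ = P₀} {P₁} {P₂} {P₃} {P₄} ≡.refl ≡.refl ≡.refl ∥₀ ∥₁ ∥₂ ∥₃ =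
    cornerCrossRatio-swap
      (cornerCrossRatio-horizontalStaircase {swap P₀} {swap P₁} {swap P₂} {swap P₃} {swap P₄} ∥₀ ∥₁ ∥₂ ∥₃)

  horizontalSide-suc : ∀ h i → horizontalSide h (i +ℤ + 1) ≡ not (horizontalSide h i)
  horizontalSide-suc h i rewrite evenℤ-suc i with evenℤ i
  ... | true  = ≡.refl
  ... | false = ≡.sym (not-involutive h)

  cornerCrossRatio-axisAligned : ∀ {h A} → AxisAligned h A → ∀ {i₀ i₁ i₂ i₃ i₄} →
    i₀ +ℤ + 1 ≡ i₁ → i₁ +ℤ + 1 ≡ i₂ → i₂ +ℤ + 1 ≡ i₃ → i₃ +ℤ + 1 ≡ i₄ →
    CornerCrossRatio (A i₀) (A i₁) (A i₂) (A i₃) (A i₄)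
      (sideLen h A i₁ * sideLen h A i₂) (sideLen h A i₀ * sideLen h A i₃)
  cornerCrossRatio-axisAligned {h} aligned {i₀} ≡.refl ≡.refl ≡.refl ≡.refl =
    cornerCrossRatio-staircase (horizontalSide h i₀)
      (horizontalSide-suc h i₀) (horizontalSide-suc h i₁) (horizontalSide-suc h i₂)
      (aligned i₀) (aligned i₁) (aligned i₂) (aligned i₃)
    where
    i₁ i₂ i₃ : ℤ
    i₁ = i₀ +ℤ + 1
    i₂ = i₁ +ℤ + 1
    i₃ = i₂ +ℤ + 1

lemma7p3 : ∀ {c ℓ : Level} (F : Field c ℓ) (n : ℕ) (h : Bool) (A : Geometry.PointSeq F) →
    let open Field F
        open Geometry F
    in Closed n A →
       AxisAligned h A →
       (∀ k → YDefined A k) →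
       ∀ j → y2 A j ≈ - ((sideLen h A (j -ℤ + 1) * sideLen h A j)
                         * (sideLen h A (j -ℤ + 2) * sideLen h A (j +ℤ + 1)) ⁻¹)
lemma7p3 F _ h A _ aligned defined j =
  let num , den     = cornerCrossRatio-axisAligned F aligned
                        (j-2+1≡j-1 j) (j-1+1≡j j) ≡.refl (j+1+1≡j+2 j)
      den≉0 , χ≉0   = defined j
  in  Field.-‿cong F (⁻¹-ratio F num den den≉0 χ≉0)
  where
  j-2+1≡j-1 : ∀ j → (j -ℤ + 2) +ℤ + 1 ≡ j -ℤ + 1
  j-2+1≡j-1 = solve-∀
  j-1+1≡j : ∀ j → (j -ℤ + 1) +ℤ + 1 ≡ j
  j-1+1≡j = solve-∀
  j+1+1≡j+2 : ∀ j → (j +ℤ + 1) +ℤ + 1 ≡ j +ℤ + 2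
  j+1+1≡j+2 = solve-∀
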